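{- For every $n$, let $C_n$ be a circuit with inputs $x_1,\dots,x_n$ computing $\mathsf{Majority}_n$ (output $1$ iff at least half of the inputs are $1$), and let $\mathsf{Q\text{ - }Majority}_n$ be the QBF $\exists x_1\cdots\exists x_n\forall u\exists t_1\cdots\exists t_m.\ (u\nleftrightarrow C_n(x_1,\dots,x_n))$. Then $\mathsf{Q\text{ - }Majority}_n$ has a Q-SoS refutation of Q-size $O(n)$.
   Context: In the formula, the variables $t_1,\dots,t_m$ are used for a Tseitin encoding of $C_n$ into CNF: the $i$-th gate of $C_n$ is represented by $t_i$ and one includes the standard clauses encoding $t_i\leftrightarrow(t_j\wedge t_k)$, $t_i\leftrightarrow(t_j\vee t_k)$ or $t_i\leftrightarrow\neg t_j$ according to the gate (with inputs possibly being the $x$'s), together with clauses expressing that $u$ differs from the output variable. Polynomial encoding: for each variable $v$ let $\overline v$ be a twin variable; a clause $C=\bigvee_{v\in P}v\vee\bigvee_{v\in N}\neg v$ is encoded as $\mathrm{enc}(C)=\{\prod_{v\in P}\overline v\prod_{v\in N}v\}\cup\{v^2-v,\ v+\overline v-1: v\in P\cup N\}$, and $\mathrm{enc}(\phi)=\bigcup_{C\in\phi}\mathrm{enc}(C)$. A Q-SoS refutation of a QBF $\mathcal Q.\phi$ is a polynomial identity over $\mathbb Q$ of the form $\sum_{p\in \mathrm{enc}(\phi)}q_pp+\sum_{u}q_u(1-2u)+q+1=0$, where $u$ ranges over universal variables, every variable $v$ or $\overline v$ occurring in $q_u$ has $v$ quantified to the left of $u$, and $q$ is a sum of squares. Its Q-size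 is the total number of monomials (with repetition) in the polynomials $q_u$. -}

module Defs where

open import Data.Nat as ℕ using (ℕ; zero; suc; _≤ᵇ_)
open import Data.Bool using (Bool; true; false; if_then_else_; _∧_; _∨_; not)
open import Data.Fin using (Fin; zero; suc; fromℕ; inject₁)
open import Data.List using (List; []; _∷_; _++_; map; concatMap; length; lookup; foldr)
open import Data.Product using (_×_; _,_; proj₁; proj₂)
open import Data.Rational using (ℚ; 0ℚ; 1ℚ; _+_; _*_; _-_; -_)
open import Relation.Binary.PropositionalEquality using (_≡_)

-- Boolean circuits (fan-in ≤ 2, gates AND / OR / NOT)
-- A wire feeding a gate at position k is either an input x_i or an
-- earlier gate t_j (j < k).

data Wire (n k : ℕ) : Set where
  inp  : Fin n → Wire n k
  gate : Fin k → Wire n k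

data Gate (n k : ℕ) : Set where
  AND : Wire n k → Wire n k → Gate n k
  OR  : Wire n k → Wire n k → Gate n k
  NOT : Wire n k → Gate n k

data Gates (n : ℕ) : ℕ → Set where
  []  : Gates n 0
  _▷_ : ∀ {k} → Gates n k → Gate n k → Gates n (suc k)

record Circuit (n : ℕ) : Set where
  field
    m     : ℕ
    gates : Gates n m
    out   : Wire n m
open Circuit public

wireVal : ∀ {n k} → (Fin n → Bool) → (Fin k → Bool) → Wire n k → Bool
wireVal x g (inp i)  = x i
wireVal x g (gate j) = g j

gateVal : ∀ {n k} → (Fin n → Bool) → (Fin k → Bool) → Gate n k → Bool
gateVal x g (AND a b) = wireVal x g a ∧ wireVal x g b
gateVal x g (OR a b)  = wireVal x g a ∨ wireVal x g b
gateVal x g (NOT a)   = not (wireVal x g a)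

snocF : ∀ {k} {A : Set} → (Fin k → A) → A → Fin (suc k) → A
snocF {zero}  f a zero    = a
snocF {suc k} f a zero    = f zero
snocF {suc k} f a (suc i) = snocF (λ j → f (suc j)) a i

gatesVal : ∀ {n k} → Gates n k → (Fin n → Bool) → Fin k → Bool
gatesVal [] x ()
gatesVal (c ▷ g) x = snocF (gatesVal c x) (gateVal x (gatesVal c x) g)

evalCircuit : ∀ {n} → Circuit n → (Fin n → Bool) → Bool
evalCircuit C x = wireVal x (gatesVal (gates C) x) (out C)

count : ∀ {n} → (Fin n → Bool) → ℕ
count {zero}  x = 0
count {suc n} x = (if x zero then 1 else 0) ℕ.+ count (λ i → x (suc i))

majority : ∀ {n} → (Fin n → Bool) → Bool
majority {n} x = n ≤ᵇ (2 ℕ.* count x)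

Computes : ∀ {n} → Circuit n → ((Fin n → Bool) → Bool) → Set
Computes C f = ∀ x → evalCircuit C x ≡ f x

data Var (n m : ℕ) : Set where
  X : Fin n → Var n m
  U : Var n m
  T : Fin m → Var n m

-- clause  ⋁_{v∈P} v ∨ ⋁_{v∈N} ¬v
record Clause (V : Set) : Set where
  constructor cl
  field
    P : List V
    N : List V
open Clause public

renameClause : ∀ {V W : Set} → (V → W) → Clause V → Clause W
renameClause f (cl p q) = cl (map f p) (map f q)

weakenT : ∀ {n m} → Var n m → Var n (suc m)
weakenT (X i) = X i
weakenT U     = U
weakenT (T j) = T (inject₁ j)

wireVar : ∀ {n k} → Wire n k → Var n k
wireVar (inp i)  = X i
wireVar (gate j) = T j

gateClauses : ∀ {n k} → Gate n k → List (Clause (Var n (suc k)))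
gateClauses {n} {k} (AND a b) =
  let t = T (fromℕ k) ; a' = weakenT (wireVar a) ; b' = weakenT (wireVar b) in
  cl (a' ∷ []) (t ∷ []) ∷ cl (b' ∷ []) (t ∷ []) ∷ cl (t ∷ []) (a' ∷ b' ∷ []) ∷ []
gateClauses {n} {k} (OR a b) =
  let t = T (fromℕ k) ; a' = weakenT (wireVar a) ; b' = weakenT (wireVar b) in
  cl (t ∷ []) (a' ∷ []) ∷ cl (t ∷ []) (b' ∷ []) ∷ cl (a' ∷ b' ∷ []) (t ∷ []) ∷ []
gateClauses {n} {k} (NOT a) =
  let t = T (fromℕ k) ; a' = weakenT (wireVar a) in
  cl (t ∷ a' ∷ []) [] ∷ cl [] (t ∷ a' ∷ []) ∷ []

tseitin : ∀ {n k} → Gates n k → List (Clause (Var n k))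
tseitin []      = []
tseitin (c ▷ g) = map (renameClause weakenT) (tseitin c) ++ gateClauses g

-- the CNF matrix of Q-Majority_n : Tseitin clauses plus  u ≠ output
QMajMatrix : ∀ {n} (C : Circuit n) → List (Clause (Var n (m C)))
QMajMatrix C =
  tseitin (gates C) ++
  (cl (U ∷ wireVar (out C) ∷ []) [] ∷ cl [] (U ∷ wireVar (out C) ∷ []) ∷ [])

-- Polynomials over ℚ in the variables v and their twins v̄
-- A literal (v , false) stands for v, (v , true) for v̄.

Lit : Set → Set
Lit V = V × Bool

Monomial : Set → Set
Monomial V = List (Lit V)

-- a polynomial is a list of monomials with coefficients (with repetition)
Poly : Set → Set
Poly V = List (ℚ × Monomial V)

var : ∀ {V} → V → Lit V
var v = v , false

bar : ∀ {V} → V → Lit V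
bar v = v , true

renamePoly : ∀ {V W : Set} → (V → W) → Poly V → Poly W
renamePoly f = map (λ { (c , mo) → c , map (λ { (v , b) → f v , b }) mo })

evalMono : ∀ {V} → (Lit V → ℚ) → Monomial V → ℚ
evalMono ρ = foldr (λ l r → ρ l * r) 1ℚ

evalPoly : ∀ {V} → (Lit V → ℚ) → Poly V → ℚ
evalPoly ρ = foldr (λ { (c , mo) r → c * evalMono ρ mo + r }) 0ℚ

encClause : ∀ {V} → Clause V → List (Poly V)
encClause {V} (cl p q) =
  ((1ℚ , map bar p ++ map var q) ∷ []) ∷ concatMap side (p ++ q)
  where
  side : V → List (Poly V)
  side v = ((1ℚ , var v ∷ var v ∷ []) ∷ (- 1ℚ , var v ∷ []) ∷ [])
         ∷ ((1ℚ , var v ∷ []) ∷ (1ℚ , bar v ∷ []) ∷ (- 1ℚ , []) ∷ [])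
         ∷ []

enc : ∀ {V} → List (Clause V) → List (Poly V)
enc = concatMap encClause

sumFin : ∀ {k} → (Fin k → ℚ) → ℚ
sumFin {zero}  f = 0ℚ
sumFin {suc k} f = f zero + sumFin (λ i → f (suc i))

sumList : List ℚ → ℚ
sumList = foldr _+_ 0ℚ

-- The only universal variable is u; q_u may only mention x's and x̄'s
-- (the variables quantified left of u), so it is a polynomial over Fin n.
-- The identity is a polynomial identity over ℚ, expressed as: the
-- left-hand side evaluates to 0 under every rational assignment.

record QSoSRefutation {n : ℕ} (C : Circuit n) : Set where
  V = Var n (m C)
  E = enc (QMajMatrix C)
  field
    qp  : Fin (length E) → Poly V
    qu  : Poly (Fin n)
    sos : List (Poly V)
    identity : ∀ (ρ : Lit V → ℚ) →
      sumFin (λ i → evalPoly ρ (qp i) * evalPoly ρ (lookup E i))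
      + evalPoly ρ (renamePoly X qu) * (1ℚ - (1ℚ + 1ℚ) * ρ (var U))
      + sumList (map (λ s → evalPoly ρ s * evalPoly ρ s) sos)
      + 1ℚ
      ≡ 0ℚ
open QSoSRefutation public

Qsize : ∀ {n} {C : Circuit n} → QSoSRefutation C → ℕ
Qsize r = length (qu r)

{-# OPTIONS --safe #-}
-- A refutation amounts to putting −q_u·(1 − 2u) − 1 into the cone: the ideal generated by enc(φ)
-- plus sums of squares. Take q_u = 2n − 1 − 4·Σ xᵢ. Modulo the ideal, the clauses of every gate
-- force its Tseitin variable to equal the arithmetized gate, so u ≡ 1 − P(x) for the arithmetized
-- circuit P, and −q_u·(1 − 2u) − 1 ≡ G(x) := −1 − q_u(x)·(2P(x) − 1). At a Boolean point with c
-- ones P is Majority, so G equals 2(2c − n) or 2(n − 1 − 2c), a natural number either way. A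
-- polynomial that is natural-valued on the Boolean cube is a sum of squares modulo the axioms
-- xᵢ² − xᵢ: split G ≡ xᵢ²·G[xᵢ≔1] + (1 − xᵢ)²·G[xᵢ≔0] and recurse. These axioms are in enc(φ)
-- because Majority depends on every input, so each xᵢ occurs in some clause. Only q_u, with n + 1
-- monomials, counts towards the Q-size.
module Submission where

open import Defs

-- ℚ's arithmetic is opened only inside this module, so that _*_ in the statement of
-- proposition3p10 below is ℕ's.
module _ where

  open import Algebra.Bundles using (Ring)
  open import Data.Bool using (Bool; true; false; if_then_else_; _∧_; _∨_; not) renaming (T to True)
  open import Data.Empty using (⊥-elim)
  open import Data.Fin using (Fin; zero; suc; fromℕ; inject₁; _≟_)
  open import Data.List using (List; []; _∷_; _++_; map; length; lookup; tabulate)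
  open import Data.List.Membership.Propositional using (_∈_)
  open import Data.List.Membership.Propositional.Properties using (∈-++⁺ˡ; ∈-++⁺ʳ; ∈-map⁺; ∈-concat⁺′)
  open import Data.List.Properties using (map-id; map-∘; map-++; length-tabulate)
  open import Data.List.Relation.Unary.Any using (here; there)
  open import Data.Nat as ℕ using (ℕ; zero; suc; _≤_; _<_; z≤n; s≤s; _∸_; _≤ᵇ_; ⌊_/2⌋; ⌈_/2⌉)
  open import Data.Nat.Properties
    using (≤ᵇ⇒≤; ≤⇒≤ᵇ; ≤ᵇ-reflects-≤; <⇒≱; ≰⇒>; m+[n∸m]≡n; +-monoʳ-≤; n≤1+n;
           ⌊n/2⌋≤n; ⌊n/2⌋≤⌈n/2⌉; ⌊n/2⌋+⌈n/2⌉≡n; ⌊n/2⌋-mono)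
    renaming (+-identityʳ to +-identityʳ-ℕ)
  open import Data.Product using (Σ-syntax; ∃-syntax; _,_; proj₁; map₂)
  open import Data.Rational using (ℚ; 0ℚ; 1ℚ; _+_; _*_; _-_; -_)
  open import Data.Rational.Properties
    using (+-0-monoid; +-*-ring; +-identityˡ; +-identityʳ; +-assoc;
           *-identityˡ; *-identityʳ; *-assoc; *-zeroˡ; *-zeroʳ; *-distribˡ-+; *-distribʳ-+)
  open import Algebra.Properties.Monoid.Mult +-0-monoid using (_×_; ×-homo-+)
  open import Algebra.Properties.Semiring.Sum (Ring.semiring +-*-ring)
    using (sum; sum-cong-≗; ∑-distrib-+; *-distribˡ-sum; sum-replicate-zero)
  open import Data.Rational.Solver using (module +-*-Solver)
  open +-*-Solver using (solve; _:+_; _:*_; _:-_; :-_; con; _:=_)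
  open import Data.Sum using (_⊎_; inj₁; inj₂; [_,_]′; map₁)
  open import Data.Vec.Functional using () renaming (_∷_ to _◂_)
  open import Function using (_∘_; id)
  open import Relation.Nullary using (yes; no)
  open import Relation.Nullary.Reflects using (ofʸ; ofⁿ)
  open import Relation.Binary.PropositionalEquality
    using (_≡_; _≢_; refl; sym; trans; cong; cong₂; subst; module ≡-Reasoning)

  -- Polynomial functions

  Assignment : Set → Set
  Assignment V = Lit V → ℚ

  module _ {V : Set} where

    evalMono-++ : ∀ ρ (m m′ : Monomial V) → evalMono ρ (m ++ m′) ≡ evalMono ρ m * evalMono ρ m′
    evalMono-++ ρ []      m′ = sym (*-identityˡ (evalMono ρ m′))
    evalMono-++ ρ (l ∷ m) m′ =
      trans (cong (ρ l *_) (evalMono-++ ρ m m′)) (sym (*-assoc (ρ l) (evalMono ρ m) (evalMono ρ m′)))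

    evalPoly-++ : ∀ ρ (p q : Poly V) → evalPoly ρ (p ++ q) ≡ evalPoly ρ p + evalPoly ρ q
    evalPoly-++ ρ []            q = sym (+-identityˡ (evalPoly ρ q))
    evalPoly-++ ρ ((c , m) ∷ p) q =
      trans (cong (c * evalMono ρ m +_) (evalPoly-++ ρ p q))
            (sym (+-assoc (c * evalMono ρ m) (evalPoly ρ p) (evalPoly ρ q)))

    scale : ℚ → Monomial V → Poly V → Poly V
    scale c m []             = []
    scale c m ((d , m′) ∷ p) = (c * d , m ++ m′) ∷ scale c m p

    evalPoly-scale : ∀ ρ c m p → evalPoly ρ (scale c m p) ≡ c * evalMono ρ m * evalPoly ρ p
    evalPoly-scale ρ c m []             = sym (*-zeroʳ (c * evalMono ρ m))
    evalPoly-scale ρ c m ((d , m′) ∷ p) =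
      trans (cong₂ (λ x y → c * d * x + y) (evalMono-++ ρ m m′) (evalPoly-scale ρ c m p))
            (solve 5 (λ c d x y z → c :* d :* (x :* y) :+ c :* x :* z := c :* x :* (d :* y :+ z))
                   refl c d (evalMono ρ m) (evalMono ρ m′) (evalPoly ρ p))

    infixl 7 _*ₚ_
    _*ₚ_ : Poly V → Poly V → Poly V
    []            *ₚ q = []
    ((c , m) ∷ p) *ₚ q = scale c m q ++ p *ₚ q

    evalPoly-* : ∀ ρ p q → evalPoly ρ (p *ₚ q) ≡ evalPoly ρ p * evalPoly ρ q
    evalPoly-* ρ []            q = sym (*-zeroˡ (evalPoly ρ q))
    evalPoly-* ρ ((c , m) ∷ p) q =
      trans (evalPoly-++ ρ (scale c m q) (p *ₚ q))
            (trans (cong₂ _+_ (evalPoly-scale ρ c m q) (evalPoly-* ρ p q))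
                   (solve 3 (λ a b r → a :* r :+ b :* r := (a :+ b) :* r)
                          refl (c * evalMono ρ m) (evalPoly ρ p) (evalPoly ρ q)))

    record IsPolynomial (f : Assignment V → ℚ) : Set where
      constructor _,_
      field
        polynomial          : Poly V
        evalPoly-polynomial : ∀ ρ → evalPoly ρ polynomial ≡ f ρ

    poly-const : ∀ c → IsPolynomial (λ _ → c)
    poly-const c = (c , []) ∷ [] , λ _ → solve 1 (λ c → c :* con 1ℚ :+ con 0ℚ := c) refl c

    poly-mono : ∀ m → IsPolynomial (λ ρ → evalMono ρ m)
    poly-mono m = (1ℚ , m) ∷ [] , λ ρ → solve 1 (λ x → con 1ℚ :* x :+ con 0ℚ := x) refl (evalMono ρ m)

    poly-lit : ∀ l → IsPolynomial (λ ρ → ρ l)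
    poly-lit l = (1ℚ , l ∷ []) ∷ [] , λ ρ → solve 1 (λ x → con 1ℚ :* (x :* con 1ℚ) :+ con 0ℚ := x) refl (ρ l)

    poly-cong : ∀ {f g} → (∀ ρ → f ρ ≡ g ρ) → IsPolynomial f → IsPolynomial g
    poly-cong f≡g (p , p≡f) = p , λ ρ → trans (p≡f ρ) (f≡g ρ)

    poly-+ : ∀ {f g} → IsPolynomial f → IsPolynomial g → IsPolynomial (λ ρ → f ρ + g ρ)
    poly-+ (p , p≡f) (q , q≡g) = p ++ q , λ ρ → trans (evalPoly-++ ρ p q) (cong₂ _+_ (p≡f ρ) (q≡g ρ))

    poly-* : ∀ {f g} → IsPolynomial f → IsPolynomial g → IsPolynomial (λ ρ → f ρ * g ρ)
    poly-* (p , p≡f) (q , q≡g) = p *ₚ q , λ ρ → trans (evalPoly-* ρ p q) (cong₂ _*_ (p≡f ρ) (q≡g ρ))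

    poly-sub : ∀ {f g} → IsPolynomial f → IsPolynomial g → IsPolynomial (λ ρ → f ρ - g ρ)
    poly-sub {f} {g} pf pg =
      poly-cong (λ ρ → solve 2 (λ x y → x :+ con (- 1ℚ) :* y := x :- y) refl (f ρ) (g ρ))
                (poly-+ pf (poly-* (poly-const (- 1ℚ)) pg))

  -- The ideal and the cone generated by a list of polynomials

  module _ {V : Set} where

    combination : (E : List (Poly V)) → (Fin (length E) → Poly V) → Assignment V → ℚ
    combination E q ρ = sum (λ i → evalPoly ρ (q i) * evalPoly ρ (lookup E i))

    record InIdeal (E : List (Poly V)) (f : Assignment V → ℚ) : Set where
      constructor _,_
      field
        coefficients             : Fin (length E) → Poly V
        combination-coefficients : ∀ ρ → combination E coefficients ρ ≡ f ρ

    module _ {E : List (Poly V)} where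

      ideal-cong : ∀ {f g} → (∀ ρ → f ρ ≡ g ρ) → InIdeal E f → InIdeal E g
      ideal-cong f≡g (q , q≡f) = q , λ ρ → trans (q≡f ρ) (f≡g ρ)

      ideal-0 : InIdeal E (λ _ → 0ℚ)
      ideal-0 = (λ _ → []) , λ ρ →
        trans (sum-cong-≗ (λ i → *-zeroˡ (evalPoly ρ (lookup E i)))) (sum-replicate-zero (length E))

      infixl 6 _+ᴵ_ _-ᴵ_
      infixr 7 _*ᴵ_

      _+ᴵ_ : ∀ {f g} → InIdeal E f → InIdeal E g → InIdeal E (λ ρ → f ρ + g ρ)
      (q , q≡f) +ᴵ (q′ , q′≡g) = (λ i → q i ++ q′ i) , λ ρ →
        let summand = λ r i → evalPoly ρ (r i) * evalPoly ρ (lookup E i) in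
        trans (sum-cong-≗ (λ i → trans (cong (_* evalPoly ρ (lookup E i)) (evalPoly-++ ρ (q i) (q′ i)))
                                        (*-distribʳ-+ (evalPoly ρ (lookup E i)) (evalPoly ρ (q i)) (evalPoly ρ (q′ i)))))
              (trans (∑-distrib-+ (summand q) (summand q′)) (cong₂ _+_ (q≡f ρ) (q′≡g ρ)))

      _*ᴵ_ : ∀ {h f} → IsPolynomial h → InIdeal E f → InIdeal E (λ ρ → h ρ * f ρ)
      (p , p≡h) *ᴵ (q , q≡f) = (λ i → p *ₚ q i) , λ ρ →
        let summand = λ i → evalPoly ρ (q i) * evalPoly ρ (lookup E i) in
        trans (sum-cong-≗ (λ i → trans (cong (_* evalPoly ρ (lookup E i)) (evalPoly-* ρ p (q i)))
                                        (*-assoc (evalPoly ρ p) (evalPoly ρ (q i)) (evalPoly ρ (lookup E i)))))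
              (trans (sym (*-distribˡ-sum (evalPoly ρ p) summand)) (cong₂ _*_ (p≡h ρ) (q≡f ρ)))

      _-ᴵ_ : ∀ {f g} → InIdeal E f → InIdeal E g → InIdeal E (λ ρ → f ρ - g ρ)
      _-ᴵ_ {f} {g} If Ig =
        ideal-cong (λ ρ → solve 2 (λ x y → x :+ con (- 1ℚ) :* y := x :- y) refl (f ρ) (g ρ))
                   (If +ᴵ poly-const (- 1ℚ) *ᴵ Ig)

    ideal-generator : ∀ {E p} → p ∈ E → InIdeal E (λ ρ → evalPoly ρ p)
    ideal-generator {e ∷ E} (here refl) = ((1ℚ , []) ∷ []) ◂ (λ _ → []) , λ ρ →
      trans (cong ((1ℚ * 1ℚ + 0ℚ) * evalPoly ρ e +_) (InIdeal.combination-coefficients (ideal-0 {E = E}) ρ))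
            (solve 1 (λ x → (con 1ℚ :* con 1ℚ :+ con 0ℚ) :* x :+ con 0ℚ := x) refl (evalPoly ρ e))
    ideal-generator {e ∷ E} {p} (there p∈E) with ideal-generator p∈E
    ... | q , q≡p = [] ◂ q , λ ρ →
      trans (cong (0ℚ * evalPoly ρ e +_) (q≡p ρ))
            (solve 2 (λ x y → con 0ℚ :* x :+ y := y) refl (evalPoly ρ e) (evalPoly ρ p))

    sumSquares : List (Poly V) → Assignment V → ℚ
    sumSquares s ρ = sumList (map (λ p → evalPoly ρ p * evalPoly ρ p) s)

    sumSquares-++ : ∀ ρ s t → sumSquares (s ++ t) ρ ≡ sumSquares s ρ + sumSquares t ρ
    sumSquares-++ ρ []      t = sym (+-identityˡ (sumSquares t ρ))
    sumSquares-++ ρ (p ∷ s) t =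
      trans (cong (evalPoly ρ p * evalPoly ρ p +_) (sumSquares-++ ρ s t))
            (sym (+-assoc (evalPoly ρ p * evalPoly ρ p) (sumSquares s ρ) (sumSquares t ρ)))

    sumSquares-map-* : ∀ ρ h s → sumSquares (map (h *ₚ_) s) ρ ≡ evalPoly ρ h * evalPoly ρ h * sumSquares s ρ
    sumSquares-map-* ρ h []      = sym (*-zeroʳ (evalPoly ρ h * evalPoly ρ h))
    sumSquares-map-* ρ h (p ∷ s) =
      trans (cong₂ (λ x y → x * x + y) (evalPoly-* ρ h p) (sumSquares-map-* ρ h s))
            (solve 3 (λ a b r → a :* b :* (a :* b) :+ a :* a :* r := a :* a :* (b :* b :+ r))
                   refl (evalPoly ρ h) (evalPoly ρ p) (sumSquares s ρ))

    record InCone (E : List (Poly V)) (f : Assignment V → ℚ) : Set where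
      constructor _,_
      field
        squares    : List (Poly V)
        remainder  : InIdeal E (λ ρ → f ρ - sumSquares squares ρ)

    module _ {E : List (Poly V)} where

      cone-cong : ∀ {f g} → (∀ ρ → f ρ ≡ g ρ) → InCone E f → InCone E g
      cone-cong f≡g (s , I) = s , ideal-cong (λ ρ → cong (_- sumSquares s ρ) (f≡g ρ)) I

      ideal⇒cone : ∀ {f} → InIdeal E f → InCone E f
      ideal⇒cone {f} I = [] , ideal-cong (λ ρ → sym (+-identityʳ (f ρ))) I

      cone-+ : ∀ {f g} → InCone E f → InCone E g → InCone E (λ ρ → f ρ + g ρ)
      cone-+ {f} {g} (s , If) (t , Ig) = s ++ t , ideal-cong regroup (If +ᴵ Ig)
        where
        regroup : ∀ ρ → f ρ - sumSquares s ρ + (g ρ - sumSquares t ρ) ≡ f ρ + g ρ - sumSquares (s ++ t) ρ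
        regroup ρ =
          trans (solve 4 (λ a b x y → a :- x :+ (b :- y) := a :+ b :- (x :+ y))
                         refl (f ρ) (g ρ) (sumSquares s ρ) (sumSquares t ρ))
                (cong (λ x → f ρ + g ρ - x) (sym (sumSquares-++ ρ s t)))

      cone-square : ∀ {h} → IsPolynomial h → InCone E (λ ρ → h ρ * h ρ)
      cone-square {h} (p , p≡h) = p ∷ [] , ideal-cong cancel ideal-0
        where
        cancel : ∀ ρ → 0ℚ ≡ h ρ * h ρ - (evalPoly ρ p * evalPoly ρ p + 0ℚ)
        cancel ρ = trans (solve 1 (λ x → con 0ℚ := x :* x :- (x :* x :+ con 0ℚ)) refl (evalPoly ρ p))
                         (cong (λ x → x * x - (evalPoly ρ p * evalPoly ρ p + 0ℚ)) (p≡h ρ))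

      cone-*-square : ∀ {h f} → IsPolynomial h → InCone E f → InCone E (λ ρ → h ρ * h ρ * f ρ)
      cone-*-square {h} {f} (p , p≡h) (s , I) =
        map (p *ₚ_) s , ideal-cong distribute (poly-* (p , p≡h) (p , p≡h) *ᴵ I)
        where
        distribute : ∀ ρ → h ρ * h ρ * (f ρ - sumSquares s ρ) ≡ h ρ * h ρ * f ρ - sumSquares (map (p *ₚ_) s) ρ
        distribute ρ rewrite sumSquares-map-* ρ p s | p≡h ρ =
          solve 3 (λ a x y → a :* a :* (x :- y) := a :* a :* x :- a :* a :* y) refl (h ρ) (f ρ) (sumSquares s ρ)

      cone-natural : ∀ k → InCone E (λ _ → k × 1ℚ)
      cone-natural zero    = ideal⇒cone ideal-0
      cone-natural (suc k) = cone-cong (λ _ → cong (_+ k × 1ℚ) (*-identityˡ 1ℚ))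
                                       (cone-+ (cone-square (poly-const 1ℚ)) (cone-natural k))

  -- Polynomial expressions in n inputs and the Boolean cube

  infixl 6 _⊕_
  infixl 7 _⊗_

  data Expr (n : ℕ) : Set where
    const   : ℚ → Expr n
    input   : Fin n → Expr n
    _⊕_ _⊗_ : Expr n → Expr n → Expr n

  ⟦_⟧ : ∀ {n} → Expr n → (Fin n → ℚ) → ℚ
  ⟦ const c ⟧ γ = c
  ⟦ input i ⟧ γ = γ i
  ⟦ G ⊕ H ⟧   γ = ⟦ G ⟧ γ + ⟦ H ⟧ γ
  ⟦ G ⊗ H ⟧   γ = ⟦ G ⟧ γ * ⟦ H ⟧ γ

  ⟦⟧-cong : ∀ {n} (G : Expr n) {γ γ′} → (∀ i → γ i ≡ γ′ i) → ⟦ G ⟧ γ ≡ ⟦ G ⟧ γ′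
  ⟦⟧-cong (const c) γ≗γ′ = refl
  ⟦⟧-cong (input i) γ≗γ′ = γ≗γ′ i
  ⟦⟧-cong (G ⊕ H)   γ≗γ′ = cong₂ _+_ (⟦⟧-cong G γ≗γ′) (⟦⟧-cong H γ≗γ′)
  ⟦⟧-cong (G ⊗ H)   γ≗γ′ = cong₂ _*_ (⟦⟧-cong G γ≗γ′) (⟦⟧-cong H γ≗γ′)

  _[0≔_] : ∀ {n} → Expr (suc n) → ℚ → Expr n
  const c       [0≔ a ] = const c
  input zero    [0≔ a ] = const a
  input (suc i) [0≔ a ] = input i
  (G ⊕ H)       [0≔ a ] = G [0≔ a ] ⊕ H [0≔ a ]
  (G ⊗ H)       [0≔ a ] = G [0≔ a ] ⊗ H [0≔ a ]

  ⟦[0≔]⟧ : ∀ {n} (G : Expr (suc n)) a γ → ⟦ G [0≔ a ] ⟧ γ ≡ ⟦ G ⟧ (a ◂ γ)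
  ⟦[0≔]⟧ (const c)       a γ = refl
  ⟦[0≔]⟧ (input zero)    a γ = refl
  ⟦[0≔]⟧ (input (suc i)) a γ = refl
  ⟦[0≔]⟧ (G ⊕ H)         a γ = cong₂ _+_ (⟦[0≔]⟧ G a γ) (⟦[0≔]⟧ H a γ)
  ⟦[0≔]⟧ (G ⊗ H)         a γ = cong₂ _*_ (⟦[0≔]⟧ G a γ) (⟦[0≔]⟧ H a γ)

  module _ {V : Set} where

    poly-⟦⟧ : ∀ {n} (x : Fin n → V) (G : Expr n) → IsPolynomial (λ ρ → ⟦ G ⟧ (ρ ∘ var ∘ x))
    poly-⟦⟧ x (const c) = poly-const c
    poly-⟦⟧ x (input i) = poly-lit (var (x i))
    poly-⟦⟧ x (G ⊕ H)   = poly-+ (poly-⟦⟧ x G) (poly-⟦⟧ x H)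
    poly-⟦⟧ x (G ⊗ H)   = poly-* (poly-⟦⟧ x G) (poly-⟦⟧ x H)

    boolean : V → Assignment V → ℚ
    boolean v ρ = ρ (var v) * ρ (var v) - ρ (var v)

    module _ {E : List (Poly V)} {n : ℕ} (x : Fin (suc n) → V) (x₀-boolean : InIdeal E (boolean (x zero))) where

      private
        x₀ : Assignment V → ℚ
        x₀ ρ = ρ (var (x zero))

        ⟦_⟧₊ : Expr n → Assignment V → ℚ
        ⟦ G ⟧₊ ρ = ⟦ G ⟧ (ρ ∘ var ∘ x ∘ suc)

        interpolate : (f₁ f₀ : Assignment V → ℚ) → Assignment V → ℚ
        interpolate f₁ f₀ ρ = x₀ ρ * f₁ ρ + (1ℚ - x₀ ρ) * f₀ ρ

        poly-interpolate : ∀ {f₁ f₀} → IsPolynomial f₁ → IsPolynomial f₀ → IsPolynomial (interpolate f₁ f₀)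
        poly-interpolate p₁ p₀ =
          poly-+ (poly-* (poly-lit (var (x zero))) p₁) (poly-* (poly-sub (poly-const 1ℚ) (poly-lit (var (x zero)))) p₀)

        poly-⟦⟧₊ : (G : Expr n) → IsPolynomial ⟦ G ⟧₊
        poly-⟦⟧₊ = poly-⟦⟧ (x ∘ suc)

      ideal-split : (G : Expr (suc n)) →
                    InIdeal E (λ ρ → ⟦ G ⟧ (ρ ∘ var ∘ x) - interpolate ⟦ G [0≔ 1ℚ ] ⟧₊ ⟦ G [0≔ 0ℚ ] ⟧₊ ρ)
      ideal-split (const c) =
        ideal-cong (λ ρ → solve 2 (λ x c → con 0ℚ := c :- (x :* c :+ (con 1ℚ :- x) :* c)) refl (x₀ ρ) c) ideal-0
      ideal-split (input zero) =
        ideal-cong (λ ρ → solve 1 (λ x → con 0ℚ := x :- (x :* con 1ℚ :+ (con 1ℚ :- x) :* con 0ℚ)) refl (x₀ ρ)) ideal-0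
      ideal-split (input (suc i)) =
        ideal-cong (λ ρ → solve 2 (λ x y → con 0ℚ := y :- (x :* y :+ (con 1ℚ :- x) :* y)) refl (x₀ ρ) (ρ (var (x (suc i)))))
                   ideal-0
      ideal-split (G ⊕ H) =
        ideal-cong (λ ρ → solve 7 (λ x a a₁ a₀ b b₁ b₀ →
                                       a :- (x :* a₁ :+ (con 1ℚ :- x) :* a₀) :+ (b :- (x :* b₁ :+ (con 1ℚ :- x) :* b₀))
                                    := a :+ b :- (x :* (a₁ :+ b₁) :+ (con 1ℚ :- x) :* (a₀ :+ b₀)))
                                  refl (x₀ ρ) (⟦ G ⟧ (ρ ∘ var ∘ x)) (⟦ G [0≔ 1ℚ ] ⟧₊ ρ) (⟦ G [0≔ 0ℚ ] ⟧₊ ρ)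
                                       (⟦ H ⟧ (ρ ∘ var ∘ x)) (⟦ H [0≔ 1ℚ ] ⟧₊ ρ) (⟦ H [0≔ 0ℚ ] ⟧₊ ρ))
                   (ideal-split G +ᴵ ideal-split H)
      -- The last summand accounts for (x a₁ + (1 − x) a₀)(x b₁ + (1 − x) b₀) − (x a₁b₁ + (1 − x) a₀b₀),
      -- which equals (x² − x)(a₁ − a₀)(b₁ − b₀).
      ideal-split (G ⊗ H) =
        ideal-cong (λ ρ → solve 7 (λ x a a₁ a₀ b b₁ b₀ →
                                       b :* (a :- (x :* a₁ :+ (con 1ℚ :- x) :* a₀))
                                       :+ (x :* a₁ :+ (con 1ℚ :- x) :* a₀) :* (b :- (x :* b₁ :+ (con 1ℚ :- x) :* b₀))
                                       :+ (a₁ :- a₀) :* (b₁ :- b₀) :* (x :* x :- x)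
                                    := a :* b :- (x :* (a₁ :* b₁) :+ (con 1ℚ :- x) :* (a₀ :* b₀)))
                                  refl (x₀ ρ) (⟦ G ⟧ (ρ ∘ var ∘ x)) (⟦ G [0≔ 1ℚ ] ⟧₊ ρ) (⟦ G [0≔ 0ℚ ] ⟧₊ ρ)
                                       (⟦ H ⟧ (ρ ∘ var ∘ x)) (⟦ H [0≔ 1ℚ ] ⟧₊ ρ) (⟦ H [0≔ 0ℚ ] ⟧₊ ρ))
                   (poly-⟦⟧ x H *ᴵ ideal-split G
                    +ᴵ poly-interpolate (poly-⟦⟧₊ (G [0≔ 1ℚ ])) (poly-⟦⟧₊ (G [0≔ 0ℚ ])) *ᴵ ideal-split H
                    +ᴵ poly-* (poly-sub (poly-⟦⟧₊ (G [0≔ 1ℚ ])) (poly-⟦⟧₊ (G [0≔ 0ℚ ])))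
                              (poly-sub (poly-⟦⟧₊ (H [0≔ 1ℚ ])) (poly-⟦⟧₊ (H [0≔ 0ℚ ])))
                       *ᴵ x₀-boolean)

  fromBool : Bool → ℚ
  fromBool true  = 1ℚ
  fromBool false = 0ℚ

  NaturalOnCube : ∀ {n} → Expr n → Set
  NaturalOnCube G = ∀ β → ∃[ k ] ⟦ G ⟧ (fromBool ∘ β) ≡ k × 1ℚ

  naturalOnCube-[0≔] : ∀ {n} (G : Expr (suc n)) → NaturalOnCube G → ∀ b → NaturalOnCube (G [0≔ fromBool b ])
  naturalOnCube-[0≔] G natural b β =
    map₂ (trans (trans (⟦[0≔]⟧ G (fromBool b) (fromBool ∘ β)) (⟦⟧-cong G fromBool-◂))) (natural (b ◂ β))
    where
    fromBool-◂ : ∀ i → (fromBool b ◂ (fromBool ∘ β)) i ≡ fromBool ((b ◂ β) i)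
    fromBool-◂ zero    = refl
    fromBool-◂ (suc i) = refl

  cone-cube : ∀ {V} {E : List (Poly V)} {n} (x : Fin n → V) → (∀ i → InIdeal E (boolean (x i))) →
              (G : Expr n) → NaturalOnCube G → InCone E (λ ρ → ⟦ G ⟧ (ρ ∘ var ∘ x))
  cone-cube {n = zero} x booleans G natural =
    let k , G≡k = natural (λ ()) in
    cone-cong (λ ρ → trans (sym G≡k) (⟦⟧-cong G (λ ()))) (cone-natural k)
  cone-cube {V} {E} {suc n} x booleans G natural =
    cone-cong (λ ρ → solve 4 (λ x g g₁ g₀ →
                                  x :* x :* g₁ :+ (con 1ℚ :- x) :* (con 1ℚ :- x) :* g₀
                                  :+ (g :- (x :* g₁ :+ (con 1ℚ :- x) :* g₀) :+ con (- 1ℚ) :* (g₁ :+ g₀) :* (x :* x :- x))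
                               := g)
                             refl (ρ (var (x zero))) (⟦ G ⟧ (ρ ∘ var ∘ x)) (rest 1ℚ ρ) (rest 0ℚ ρ))
      (cone-+ (cone-+ (cone-*-square (poly-lit (var (x zero))) (branch true))
                      (cone-*-square (poly-sub (poly-const 1ℚ) (poly-lit (var (x zero)))) (branch false)))
              (ideal⇒cone (ideal-split x (booleans zero) G
                           +ᴵ poly-* (poly-const (- 1ℚ)) (poly-+ (poly-rest 1ℚ) (poly-rest 0ℚ)) *ᴵ booleans zero)))
    where
    rest : ℚ → Assignment V → ℚ
    rest a ρ = ⟦ G [0≔ a ] ⟧ (ρ ∘ var ∘ x ∘ suc)

    poly-rest : ∀ a → IsPolynomial (rest a)
    poly-rest a = poly-⟦⟧ (x ∘ suc) (G [0≔ a ])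

    branch : ∀ b → InCone E (rest (fromBool b))
    branch b = cone-cube (x ∘ suc) (booleans ∘ suc) (G [0≔ fromBool b ]) (naturalOnCube-[0≔] G natural b)

  -- The encoding of a CNF

  module _ {V : Set} where

    twin : V → Assignment V → ℚ
    twin v ρ = ρ (var v) + ρ (bar v) - 1ℚ

    untwin : Assignment V → Assignment V
    untwin ρ (v , false) = ρ (var v)
    untwin ρ (v , true)  = 1ℚ - ρ (var v)

    falsified : Clause V → Assignment V → ℚ
    falsified (cl p q) ρ = evalMono (untwin ρ) (map bar p ++ map var q)

    renameClause-∘ : ∀ {W Z : Set} (f : V → W) (g : W → Z) c → renameClause g (renameClause f c) ≡ renameClause (g ∘ f) c
    renameClause-∘ f g (cl p q) = cong₂ cl (sym (map-∘ p)) (sym (map-∘ q))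

    renameClause-id : (c : Clause V) → renameClause id c ≡ c
    renameClause-id (cl p q) = cong₂ cl (map-id p) (map-id q)

    monomial-untwin : ∀ {E} (m : Monomial V) → (∀ {v} → v ∈ map proj₁ m → InIdeal E (twin v)) →
                      InIdeal E (λ ρ → evalMono ρ m - evalMono (untwin ρ) m)
    monomial-untwin []                _     = ideal-cong (λ _ → solve 0 (con 0ℚ := con 1ℚ :- con 1ℚ) refl) ideal-0
    monomial-untwin ((v , false) ∷ m) twins =
      ideal-cong (λ ρ → solve 3 (λ x a b → x :* (a :- b) := x :* a :- x :* b)
                                refl (ρ (var v)) (evalMono ρ m) (evalMono (untwin ρ) m))
                 (poly-lit (var v) *ᴵ monomial-untwin m (twins ∘ there))
    monomial-untwin ((v , true) ∷ m) twins =
      ideal-cong (λ ρ → solve 4 (λ x x̄ a b → a :* (x :+ x̄ :- con 1ℚ) :+ (con 1ℚ :- x) :* (a :- b)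
                                          := x̄ :* a :- (con 1ℚ :- x) :* b)
                                refl (ρ (var v)) (ρ (bar v)) (evalMono ρ m) (evalMono (untwin ρ) m))
                 (poly-mono m *ᴵ twins (here refl)
                  +ᴵ poly-sub (poly-const 1ℚ) (poly-lit (var v)) *ᴵ monomial-untwin m (twins ∘ there))

    module _ {φ : List (Clause V)} {c : Clause V} (c∈φ : c ∈ φ) where

      private
        encClause⊆enc : ∀ {p} → p ∈ encClause c → p ∈ enc φ
        encClause⊆enc p∈c = ∈-concat⁺′ p∈c (∈-map⁺ encClause c∈φ)

      boolean-∈ : ∀ {v} → v ∈ P c ++ N c → InIdeal (enc φ) (boolean v)
      boolean-∈ {v} v∈c =
        ideal-cong (λ ρ → solve 1 (λ x → con 1ℚ :* (x :* (x :* con 1ℚ)) :+ (con (- 1ℚ) :* (x :* con 1ℚ) :+ con 0ℚ)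
                                      := x :* x :- x)
                                  refl (ρ (var v)))
                   (ideal-generator (encClause⊆enc (there (∈-concat⁺′ (here refl) (∈-map⁺ _ v∈c)))))

      twin-∈ : ∀ {v} → v ∈ P c ++ N c → InIdeal (enc φ) (twin v)
      twin-∈ {v} v∈c =
        ideal-cong (λ ρ → solve 2 (λ x x̄ → con 1ℚ :* (x :* con 1ℚ)
                                           :+ (con 1ℚ :* (x̄ :* con 1ℚ) :+ (con (- 1ℚ) :* con 1ℚ :+ con 0ℚ))
                                        := x :+ x̄ :- con 1ℚ)
                                  refl (ρ (var v)) (ρ (bar v)))
                   (ideal-generator (encClause⊆enc (there (∈-concat⁺′ (there (here refl)) (∈-map⁺ _ v∈c)))))

      falsified-∈ : InIdeal (enc φ) (falsified c)
      falsified-∈ =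
        ideal-cong (λ ρ → solve 2 (λ e f → con 1ℚ :* e :+ con 0ℚ :- (e :- f) := f)
                                  refl (evalMono ρ monomial) (evalMono (untwin ρ) monomial))
                   (ideal-generator (encClause⊆enc (here refl)) -ᴵ monomial-untwin monomial (twin-∈ ∘ variable-of-clause))
        where
        monomial : Monomial V
        monomial = map bar (P c) ++ map var (N c)

        map-proj₁-lits : ∀ {b} (vs : List V) → map proj₁ (map (_, b) vs) ≡ vs
        map-proj₁-lits vs = trans (sym (map-∘ vs)) (map-id vs)

        variable-of-clause : ∀ {v} → v ∈ map proj₁ monomial → v ∈ P c ++ N c
        variable-of-clause {v} =
          subst (v ∈_) (trans (map-++ proj₁ (map bar (P c)) (map var (N c)))
                              (cong₂ _++_ (map-proj₁-lits (P c)) (map-proj₁-lits (N c))))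

  -- Arithmetization of circuits

  snocF-ind : ∀ {k} {A : Set} (P : Fin (suc k) → A → Set) {f : Fin k → A} {a} →
              (∀ j → P (inject₁ j) (f j)) → P (fromℕ k) a → ∀ j → P j (snocF f a j)
  snocF-ind {zero}  P Pf Pa zero    = Pa
  snocF-ind {suc k} P Pf Pa zero    = Pf zero
  snocF-ind {suc k} P Pf Pa (suc j) = snocF-ind (P ∘ suc) (Pf ∘ suc) Pa j

  snocF-rel : ∀ {k} {A B : Set} (R : A → B → Set) {f : Fin k → A} {g : Fin k → B} {a b} →
              (∀ j → R (f j) (g j)) → R a b → ∀ j → R (snocF f a j) (snocF g b j)
  snocF-rel {zero}  R Rfg Rab zero    = Rab
  snocF-rel {suc k} R Rfg Rab zero    = Rfg zero
  snocF-rel {suc k} R Rfg Rab (suc j) = snocF-rel R (Rfg ∘ suc) Rab j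

  module _ {n : ℕ} where

    wireExpr : ∀ {k} → (Fin k → Expr n) → Wire n k → Expr n
    wireExpr G (inp i)  = input i
    wireExpr G (gate j) = G j

    gateExpr : ∀ {k} → (Fin k → Expr n) → Gate n k → Expr n
    gateExpr G (AND a b) = wireExpr G a ⊗ wireExpr G b
    gateExpr G (OR a b)  = wireExpr G a ⊕ wireExpr G b ⊕ const (- 1ℚ) ⊗ wireExpr G a ⊗ wireExpr G b
    gateExpr G (NOT a)   = const 1ℚ ⊕ const (- 1ℚ) ⊗ wireExpr G a

    gatesExpr : ∀ {k} → Gates n k → Fin k → Expr n
    gatesExpr []       ()
    gatesExpr (gs ▷ g) = snocF (gatesExpr gs) (gateExpr (gatesExpr gs) g)

    outputExpr : Circuit n → Expr n
    outputExpr C = wireExpr (gatesExpr (gates C)) (out C)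

    module _ (β : Fin n → Bool) where

      private
        Sound : ∀ {k} → (Fin k → Expr n) → (Fin k → Bool) → Set
        Sound G v = ∀ j → ⟦ G j ⟧ (fromBool ∘ β) ≡ fromBool (v j)

      wireExpr-sound : ∀ {k} {G : Fin k → Expr n} {v} → Sound G v →
                       ∀ w → ⟦ wireExpr G w ⟧ (fromBool ∘ β) ≡ fromBool (wireVal β v w)
      wireExpr-sound G≈v (inp i)  = refl
      wireExpr-sound G≈v (gate j) = G≈v j

      gateExpr-sound : ∀ {k} {G : Fin k → Expr n} {v} → Sound G v →
                       ∀ g → ⟦ gateExpr G g ⟧ (fromBool ∘ β) ≡ fromBool (gateVal β v g)
      gateExpr-sound {v = v} G≈v (AND a b) =
        trans (cong₂ _*_ (wireExpr-sound G≈v a) (wireExpr-sound G≈v b)) (fromBool-∧ (wireVal β v a) (wireVal β v b))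
        where
        fromBool-∧ : ∀ a b → fromBool a * fromBool b ≡ fromBool (a ∧ b)
        fromBool-∧ true  b = *-identityˡ (fromBool b)
        fromBool-∧ false b = *-zeroˡ (fromBool b)
      gateExpr-sound {v = v} G≈v (OR a b) =
        trans (cong₂ (λ x y → x + y + - 1ℚ * x * y) (wireExpr-sound G≈v a) (wireExpr-sound G≈v b))
              (fromBool-∨ (wireVal β v a) (wireVal β v b))
        where
        fromBool-∨ : ∀ a b → fromBool a + fromBool b + - 1ℚ * fromBool a * fromBool b ≡ fromBool (a ∨ b)
        fromBool-∨ true  true  = refl
        fromBool-∨ true  false = refl
        fromBool-∨ false true  = refl
        fromBool-∨ false false = refl
      gateExpr-sound {v = v} G≈v (NOT a) =
        trans (cong (λ x → 1ℚ + - 1ℚ * x) (wireExpr-sound G≈v a)) (fromBool-not (wireVal β v a))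
        where
        fromBool-not : ∀ a → 1ℚ + - 1ℚ * fromBool a ≡ fromBool (not a)
        fromBool-not true  = refl
        fromBool-not false = refl

      gatesExpr-sound : ∀ {k} (gs : Gates n k) → Sound (gatesExpr gs) (gatesVal gs β)
      gatesExpr-sound []       ()
      gatesExpr-sound (gs ▷ g) =
        snocF-rel (λ e b → ⟦ e ⟧ (fromBool ∘ β) ≡ fromBool b) (gatesExpr-sound gs) (gateExpr-sound (gatesExpr-sound gs) g)

      outputExpr-sound : (C : Circuit n) → ⟦ outputExpr C ⟧ (fromBool ∘ β) ≡ fromBool (evalCircuit C β)
      outputExpr-sound C = wireExpr-sound (gatesExpr-sound (gates C)) (out C)

  -- The Tseitin clauses modulo the ideal

  AgreeOff : ∀ {n} → Fin n → (Fin n → Bool) → (Fin n → Bool) → Set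
  AgreeOff i β β′ = ∀ j → j ≢ i → β j ≡ β′ j

  cong₂-⊎ : ∀ {A B C Z : Set} (f : A → B → C) {x x′ y y′} →
            x ≡ x′ ⊎ Z → y ≡ y′ ⊎ Z → f x y ≡ f x′ y′ ⊎ Z
  cong₂-⊎ f (inj₁ x≡x′) (inj₁ y≡y′) = inj₁ (cong₂ f x≡x′ y≡y′)
  cong₂-⊎ f (inj₁ _)    (inj₂ z)    = inj₂ z
  cong₂-⊎ f (inj₂ z)    _           = inj₂ z

  module Tseitin {n M : ℕ} (φ : List (Clause (Var n M))) where

    record Embeds {k} (gs : Gates n k) (ι : Var n k → Var n M) : Set where
      field
        embeds : ∀ {c} → c ∈ tseitin gs → renameClause ι c ∈ φ
    open Embeds

    embeds-prefix : ∀ {k} {gs : Gates n k} {g ι} → Embeds (gs ▷ g) ι → Embeds gs (ι ∘ weakenT)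
    embeds (embeds-prefix {ι = ι} gs▷g) {c} c∈gs =
      subst (_∈ φ) (renameClause-∘ weakenT ι c) (embeds gs▷g (∈-++⁺ˡ (∈-map⁺ (renameClause weakenT) c∈gs)))

    embeds-gate : ∀ {k} {gs : Gates n k} {g ι} → Embeds (gs ▷ g) ι → ∀ {c} → c ∈ gateClauses g → renameClause ι c ∈ φ
    embeds-gate {gs = gs} gs▷g c∈g = embeds gs▷g (∈-++⁺ʳ (map (renameClause weakenT) (tseitin gs)) c∈g)

    Tracks : ∀ {k} → (Var n k → Var n M) → Var n k → Expr n → Set
    Tracks ι v e = InIdeal (enc φ) (λ ρ → ρ (var (ι v)) - ⟦ e ⟧ (ρ ∘ var ∘ ι ∘ X))

    wire-tracks : ∀ {k ι} {G : Fin k → Expr n} → (∀ j → Tracks ι (T j) (G j)) → ∀ w → Tracks ι (wireVar w) (wireExpr G w)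
    wire-tracks {ι = ι} tracks (inp i)  = ideal-cong (λ ρ → solve 1 (λ x → con 0ℚ := x :- x) refl (ρ (var (ι (X i))))) ideal-0
    wire-tracks         tracks (gate j) = tracks j

    -- t − gate(a, b) is a combination of the falsified-clause polynomials of the gate, e.g.
    -- t − ab = (1 − a)t + a(1 − b)t − (1 − t)ab for AND, plus multiples of a − A and b − B for the
    -- expressions A, B of the input wires.
    gate-tracks : ∀ {k} {gs : Gates n k} {g ι} → Embeds (gs ▷ g) ι →
                  (∀ j → Tracks (ι ∘ weakenT) (T j) (gatesExpr gs j)) → Tracks ι (T (fromℕ k)) (gateExpr (gatesExpr gs) g)
    gate-tracks {k} {gs} {AND a b} {ι} gs▷g tracks =
      ideal-cong (λ ρ → solve 5 (λ x y t x′ y′ →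
                                     (con 1ℚ :- x) :* (t :* con 1ℚ) :+ x :* ((con 1ℚ :- y) :* (t :* con 1ℚ))
                                     :- (con 1ℚ :- t) :* (x :* (y :* con 1ℚ)) :+ y :* (x :- x′) :+ x′ :* (y :- y′)
                                  := t :- x′ :* y′)
                                refl (ρ (var (ι a′))) (ρ (var (ι b′))) (ρ (var (ι t)))
                                     (⟦ A ⟧ (ρ ∘ var ∘ ι ∘ X)) (⟦ B ⟧ (ρ ∘ var ∘ ι ∘ X)))
                 (a∨¬t +ᴵ poly-lit (var (ι a′)) *ᴵ b∨¬t -ᴵ t∨¬a∨¬b
                  +ᴵ poly-lit (var (ι b′)) *ᴵ wire a +ᴵ poly-⟦⟧ (ι ∘ X) A *ᴵ wire b)
      where
      t a′ b′ : Var n (suc k)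
      t  = T (fromℕ k)
      a′ = weakenT (wireVar a)
      b′ = weakenT (wireVar b)
      A B : Expr n
      A = wireExpr (gatesExpr gs) a
      B = wireExpr (gatesExpr gs) b
      wire : ∀ w → Tracks (ι ∘ weakenT) (wireVar w) (wireExpr (gatesExpr gs) w)
      wire = wire-tracks {ι = ι ∘ weakenT} tracks
      a∨¬t    : InIdeal (enc φ) (falsified (renameClause ι (cl (a′ ∷ []) (t ∷ []))))
      b∨¬t    : InIdeal (enc φ) (falsified (renameClause ι (cl (b′ ∷ []) (t ∷ []))))
      t∨¬a∨¬b : InIdeal (enc φ) (falsified (renameClause ι (cl (t ∷ []) (a′ ∷ b′ ∷ []))))
      a∨¬t    = falsified-∈ (embeds-gate gs▷g (here refl))
      b∨¬t    = falsified-∈ (embeds-gate gs▷g (there (here refl)))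
      t∨¬a∨¬b = falsified-∈ (embeds-gate gs▷g (there (there (here refl))))
    gate-tracks {k} {gs} {OR a b} {ι} gs▷g tracks =
      ideal-cong (λ ρ → solve 5 (λ x y t x′ y′ →
                                     (con 1ℚ :- x) :* ((con 1ℚ :- y) :* (t :* con 1ℚ))
                                     :- (con 1ℚ :- y) :* ((con 1ℚ :- t) :* (x :* con 1ℚ)) :- (con 1ℚ :- t) :* (y :* con 1ℚ)
                                     :+ (con 1ℚ :- y) :* (x :- x′) :+ (con 1ℚ :- x′) :* (y :- y′)
                                  := t :- (x′ :+ y′ :+ con (- 1ℚ) :* x′ :* y′))
                                refl (ρ (var (ι a′))) (ρ (var (ι b′))) (ρ (var (ι t)))
                                     (⟦ A ⟧ (ρ ∘ var ∘ ι ∘ X)) (⟦ B ⟧ (ρ ∘ var ∘ ι ∘ X)))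
                 (a∨b∨¬t -ᴵ 1-b *ᴵ t∨¬a -ᴵ t∨¬b
                  +ᴵ 1-b *ᴵ wire a +ᴵ poly-sub (poly-const 1ℚ) (poly-⟦⟧ (ι ∘ X) A) *ᴵ wire b)
      where
      t a′ b′ : Var n (suc k)
      t  = T (fromℕ k)
      a′ = weakenT (wireVar a)
      b′ = weakenT (wireVar b)
      A B : Expr n
      A = wireExpr (gatesExpr gs) a
      B = wireExpr (gatesExpr gs) b
      wire : ∀ w → Tracks (ι ∘ weakenT) (wireVar w) (wireExpr (gatesExpr gs) w)
      wire = wire-tracks {ι = ι ∘ weakenT} tracks
      1-b : IsPolynomial (λ ρ → 1ℚ - ρ (var (ι b′)))
      1-b = poly-sub (poly-const 1ℚ) (poly-lit (var (ι b′)))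
      t∨¬a   : InIdeal (enc φ) (falsified (renameClause ι (cl (t ∷ []) (a′ ∷ []))))
      t∨¬b   : InIdeal (enc φ) (falsified (renameClause ι (cl (t ∷ []) (b′ ∷ []))))
      a∨b∨¬t : InIdeal (enc φ) (falsified (renameClause ι (cl (a′ ∷ b′ ∷ []) (t ∷ []))))
      t∨¬a   = falsified-∈ (embeds-gate gs▷g (here refl))
      t∨¬b   = falsified-∈ (embeds-gate gs▷g (there (here refl)))
      a∨b∨¬t = falsified-∈ (embeds-gate gs▷g (there (there (here refl))))

    gate-tracks {k} {gs} {NOT a} {ι} gs▷g tracks =
      ideal-cong (λ ρ → solve 3 (λ x t x′ →
                                     t :* (x :* con 1ℚ) :- (con 1ℚ :- t) :* ((con 1ℚ :- x) :* con 1ℚ) :- (x :- x′)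
                                  := t :- (con 1ℚ :+ con (- 1ℚ) :* x′))
                                refl (ρ (var (ι a′))) (ρ (var (ι t))) (⟦ A ⟧ (ρ ∘ var ∘ ι ∘ X)))
                 (¬t∨¬a -ᴵ t∨a -ᴵ wire-tracks {ι = ι ∘ weakenT} {gatesExpr gs} tracks a)
      where
      t a′ : Var n (suc k)
      t  = T (fromℕ k)
      a′ = weakenT (wireVar a)
      A : Expr n
      A = wireExpr (gatesExpr gs) a
      t∨a   : InIdeal (enc φ) (falsified (renameClause ι (cl (t ∷ a′ ∷ []) [])))
      ¬t∨¬a : InIdeal (enc φ) (falsified (renameClause ι (cl [] (t ∷ a′ ∷ []))))
      t∨a   = falsified-∈ (embeds-gate gs▷g (here refl))
      ¬t∨¬a = falsified-∈ (embeds-gate gs▷g (there (here refl)))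

    gates-tracks : ∀ {k} {gs : Gates n k} {ι} → Embeds gs ι → ∀ j → Tracks ι (T j) (gatesExpr gs j)
    gates-tracks {gs = []}     _    ()
    gates-tracks {gs = gs ▷ g} {ι} gs▷g = snocF-ind (λ j e → Tracks ι (T j) e) prefix (gate-tracks {gs = gs} {g} gs▷g prefix)
      where
      prefix : ∀ j → Tracks (ι ∘ weakenT) (T j) (gatesExpr gs j)
      prefix = gates-tracks (embeds-prefix {gs = gs} {g} gs▷g)

    -- Either the circuit never reads input i, and then its gates cannot tell β from β′,
    -- or xᵢ occurs in a clause and its Boolean axiom is among the generators.
    module _ {i : Fin n} {β β′ : Fin n → Bool} (agree : AgreeOff i β β′) where

      wire-agrees-or-boolean : ∀ {k} {ι : Var n k → Var n M} {v v′ : Fin k → Bool} (w : Wire n k) →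
                               InIdeal (enc φ) (boolean (ι (wireVar w))) → (∀ j → v j ≡ v′ j) →
                               wireVal β v w ≡ wireVal β′ v′ w ⊎ InIdeal (enc φ) (boolean (ι (X i)))
      wire-agrees-or-boolean (inp j) w-boolean v≗v′ with j ≟ i
      ... | yes refl = inj₂ w-boolean
      ... | no j≢i   = inj₁ (agree j j≢i)
      wire-agrees-or-boolean (gate j) _ v≗v′ = inj₁ (v≗v′ j)

      gate-agrees-or-boolean : ∀ {k} {gs : Gates n k} {g ι} {v v′ : Fin k → Bool} → Embeds (gs ▷ g) ι →
                               (∀ j → v j ≡ v′ j) →
                               gateVal β v g ≡ gateVal β′ v′ g ⊎ InIdeal (enc φ) (boolean (ι (X i)))
      gate-agrees-or-boolean {g = AND a b} {ι} gs▷g v≗v′ =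
        cong₂-⊎ _∧_
          (wire-agrees-or-boolean {ι = ι ∘ weakenT} a (boolean-∈ (embeds-gate gs▷g (here refl)) (here refl)) v≗v′)
          (wire-agrees-or-boolean {ι = ι ∘ weakenT} b (boolean-∈ (embeds-gate gs▷g (there (here refl))) (here refl)) v≗v′)
      gate-agrees-or-boolean {g = OR a b} {ι} gs▷g v≗v′ =
        cong₂-⊎ _∨_
          (wire-agrees-or-boolean {ι = ι ∘ weakenT} a (boolean-∈ (embeds-gate gs▷g (here refl)) (there (here refl))) v≗v′)
          (wire-agrees-or-boolean {ι = ι ∘ weakenT} b (boolean-∈ (embeds-gate gs▷g (there (here refl))) (there (here refl))) v≗v′)
      gate-agrees-or-boolean {g = NOT a} {ι} gs▷g v≗v′ =
        map₁ (cong not)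
          (wire-agrees-or-boolean {ι = ι ∘ weakenT} a (boolean-∈ (embeds-gate gs▷g (here refl)) (there (here refl))) v≗v′)

      gates-agree-or-boolean : ∀ {k} {gs : Gates n k} {ι} → Embeds gs ι →
                               (∀ j → gatesVal gs β j ≡ gatesVal gs β′ j) ⊎ InIdeal (enc φ) (boolean (ι (X i)))
      gates-agree-or-boolean {gs = []}     _    = inj₁ (λ ())
      gates-agree-or-boolean {gs = gs ▷ g} gs▷g =
        [ (λ prefix-agrees → map₁ (snocF-rel _≡_ prefix-agrees) (gate-agrees-or-boolean {gs = gs} gs▷g prefix-agrees))
        , inj₂
        ]′ (gates-agree-or-boolean {gs = gs} (embeds-prefix {g = g} gs▷g))

  -- Q-Majority

  record SensitiveAt {n} (f : (Fin n → Bool) → Bool) (i : Fin n) : Set where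
    field
      low high : Fin n → Bool
      agree    : AgreeOff i low high
      differ   : f low ≢ f high

  module _ {n : ℕ} (C : Circuit n) where

    open Tseitin (QMajMatrix C)

    private
      u∨out : cl (U ∷ wireVar (out C) ∷ []) [] ∈ QMajMatrix C
      u∨out = ∈-++⁺ʳ (tseitin (gates C)) (here refl)

      ¬u∨¬out : cl [] (U ∷ wireVar (out C) ∷ []) ∈ QMajMatrix C
      ¬u∨¬out = ∈-++⁺ʳ (tseitin (gates C)) (there (here refl))

      gates-embed : Embeds (gates C) id
      gates-embed = record { embeds = λ {c} c∈ → subst (_∈ QMajMatrix C) (sym (renameClause-id c)) (∈-++⁺ˡ c∈) }

    input-boolean : ∀ {f i} → Computes C f → SensitiveAt f i → InIdeal (enc (QMajMatrix C)) (boolean (X i))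
    input-boolean {i = i} computes s = [ output-agrees-or-boolean , id ]′ (gates-agree-or-boolean agree gates-embed)
      where
      open SensitiveAt s

      output-agrees-or-boolean : (∀ j → gatesVal (gates C) low j ≡ gatesVal (gates C) high j) →
                                 InIdeal (enc (QMajMatrix C)) (boolean (X i))
      output-agrees-or-boolean gates-agree =
        [ (λ outputs-agree → ⊥-elim (differ (trans (sym (computes low)) (trans outputs-agree (computes high))))) , id ]′
        (wire-agrees-or-boolean agree {ι = id} (out C) (boolean-∈ u∨out (there (here refl))) gates-agree)

    u-tracks : InIdeal (enc (QMajMatrix C)) (λ ρ → ρ (var U) - (1ℚ - ⟦ outputExpr C ⟧ (ρ ∘ var ∘ X)))
    u-tracks =
      ideal-cong (λ ρ → solve 3 (λ u w o → u :* (w :* con 1ℚ) :- (con 1ℚ :- u) :* ((con 1ℚ :- w) :* con 1ℚ) :- (w :- o)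
                                        := u :- (con 1ℚ :- o))
                                refl (ρ (var U)) (ρ (var (wireVar (out C)))) (⟦ outputExpr C ⟧ (ρ ∘ var ∘ X)))
                 (falsified-∈ ¬u∨¬out -ᴵ falsified-∈ u∨out
                  -ᴵ wire-tracks {ι = id} {gatesExpr (gates C)} (gates-tracks gates-embed) (out C))

  refutation-from-cone : ∀ {n} (C : Circuit n) (q : Poly (Fin n)) →
    InCone (enc (QMajMatrix C)) (λ ρ → - (evalPoly ρ (renamePoly X q) * (1ℚ - (1ℚ + 1ℚ) * ρ (var U))) - 1ℚ) →
    Σ[ r ∈ QSoSRefutation C ] qu r ≡ q
  refutation-from-cone {n} C q (s , (coefficients , combination≡)) =
    record { qp = coefficients ; qu = q ; sos = s ; identity = vanishes } , refl
    where
    sumFin≡sum : ∀ {k} (f : Fin k → ℚ) → sumFin f ≡ sum f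
    sumFin≡sum {zero}  f = refl
    sumFin≡sum {suc k} f = cong (f zero +_) (sumFin≡sum (f ∘ suc))

    summand : Assignment (Var n (m C)) → Fin (length (enc (QMajMatrix C))) → ℚ
    summand ρ i = evalPoly ρ (coefficients i) * evalPoly ρ (lookup (enc (QMajMatrix C)) i)

    vanishes : ∀ ρ → sumFin (summand ρ) + evalPoly ρ (renamePoly X q) * (1ℚ - (1ℚ + 1ℚ) * ρ (var U))
                     + sumSquares s ρ + 1ℚ ≡ 0ℚ
    vanishes ρ =
      trans (cong (λ l → l + a * w + sumSquares s ρ + 1ℚ) (trans (sumFin≡sum (summand ρ)) (combination≡ ρ)))
            (solve 3 (λ a w t → :- (a :* w) :- con 1ℚ :- t :+ a :* w :+ t :+ con 1ℚ := con 0ℚ) refl a w (sumSquares s ρ))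
      where
      a w : ℚ
      a = evalPoly ρ (renamePoly X q)
      w = 1ℚ - (1ℚ + 1ℚ) * ρ (var U)

  2*m≡m+m : ∀ m → 2 ℕ.* m ≡ m ℕ.+ m
  2*m≡m+m m = cong (m ℕ.+_) (+-identityʳ-ℕ m)

  ones : ∀ {n} → ℕ → Fin n → Bool
  ones zero    _       = false
  ones (suc c) zero    = true
  ones (suc c) (suc j) = ones c j

  count-ones : ∀ {n} c → c ≤ n → count {n} (ones c) ≡ c
  count-ones {zero}  zero    z≤n       = refl
  count-ones {suc n} zero    z≤n       = count-ones {n} zero z≤n
  count-ones {suc n} (suc c) (s≤s c≤n) = cong suc (count-ones c c≤n)

  withOnes : ∀ {n} → Fin n → ℕ → Bool → Fin n → Bool
  withOnes zero    c       b = b ◂ ones c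
  withOnes (suc i) zero    b = false ◂ withOnes i zero b
  withOnes (suc i) (suc c) b = true ◂ withOnes i c b

  count-withOnes : ∀ {n} (i : Fin (suc n)) c b → c ≤ n → count (withOnes i c b) ≡ (if b then suc c else c)
  count-withOnes         zero    c       true  c≤n       = cong suc (count-ones c c≤n)
  count-withOnes         zero    c       false c≤n       = count-ones c c≤n
  count-withOnes {suc n} (suc i) zero    b     _         = count-withOnes i zero b z≤n
  count-withOnes {suc n} (suc i) (suc c) true  (s≤s c≤n) = cong suc (count-withOnes i c true c≤n)
  count-withOnes {suc n} (suc i) (suc c) false (s≤s c≤n) = cong suc (count-withOnes i c false c≤n)

  withOnes-agree : ∀ {n} (i : Fin n) c → AgreeOff i (withOnes i c false) (withOnes i c true)
  withOnes-agree zero    c       zero    j≢i = ⊥-elim (j≢i refl)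
  withOnes-agree zero    c       (suc j) _   = refl
  withOnes-agree (suc i) zero    zero    _   = refl
  withOnes-agree (suc i) zero    (suc j) j≢i = withOnes-agree i zero j (j≢i ∘ cong suc)
  withOnes-agree (suc i) (suc c) zero    _   = refl
  withOnes-agree (suc i) (suc c) (suc j) j≢i = withOnes-agree i c j (j≢i ∘ cong suc)

  majority-sensitive : ∀ {n} (i : Fin n) → SensitiveAt majority i
  majority-sensitive {suc n} i = record
    { low    = withOnes i c false
    ; high   = withOnes i c true
    ; agree  = withOnes-agree i c
    ; differ = λ same → <⇒≱ low-minority
                              (≤ᵇ⇒≤ (suc n) (2 ℕ.* c) (subst True (thresholds same) (≤⇒≤ᵇ high-majority)))
    }
    where
    c : ℕ
    c = ⌊ n /2⌋

    majority-withOnes : ∀ b → majority (withOnes i c b) ≡ (suc n ≤ᵇ 2 ℕ.* (if b then suc c else c))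
    majority-withOnes b = cong (λ k → suc n ≤ᵇ 2 ℕ.* k) (count-withOnes i c b (⌊n/2⌋≤n n))

    thresholds : majority (withOnes i c false) ≡ majority (withOnes i c true) →
                 (suc n ≤ᵇ 2 ℕ.* suc c) ≡ (suc n ≤ᵇ 2 ℕ.* c)
    thresholds same = trans (sym (majority-withOnes true)) (trans (sym same) (majority-withOnes false))

    halves : c ℕ.+ ⌈ n /2⌉ ≡ n
    halves = ⌊n/2⌋+⌈n/2⌉≡n n

    low-minority : 2 ℕ.* c < suc n
    low-minority = s≤s (subst (ℕ._≤ n) (sym (2*m≡m+m c)) (subst (c ℕ.+ c ≤_) halves (+-monoʳ-≤ c (⌊n/2⌋≤⌈n/2⌉ n))))

    high-majority : suc n ≤ 2 ℕ.* suc c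
    high-majority = subst (suc n ≤_) (sym (2*m≡m+m (suc c)))
                          (s≤s (subst (_≤ c ℕ.+ suc c) halves (+-monoʳ-≤ c (⌊n/2⌋-mono (n≤1+n (suc n))))))

  slack : ℚ → ℚ → ℚ → ℚ
  slack n̂ ĉ M = - 1ℚ + - 1ℚ * (n̂ + n̂ - 1ℚ + - (4 × 1ℚ) * ĉ) * ((1ℚ + 1ℚ) * M + - 1ℚ)

  slack-natural : ∀ n c → ∃[ k ] slack (n × 1ℚ) (c × 1ℚ) (fromBool (n ≤ᵇ 2 ℕ.* c)) ≡ k × 1ℚ
  slack-natural n c with n ≤ᵇ 2 ℕ.* c | ≤ᵇ-reflects-≤ n (2 ℕ.* c)
  ... | true  | ofʸ n≤2c = d ℕ.+ d , (begin
      slack n̂ ĉ 1ℚ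
        ≡⟨ solve 2 (λ n̂ ĉ → con (- 1ℚ) :+ con (- 1ℚ) :* (n̂ :+ n̂ :- con 1ℚ :+ con (- (4 × 1ℚ)) :* ĉ)
                                          :* ((con 1ℚ :+ con 1ℚ) :* con 1ℚ :+ con (- 1ℚ))
                           := ĉ :+ ĉ :+ (ĉ :+ ĉ) :- (n̂ :+ n̂))
                 refl n̂ ĉ ⟩
      ĉ + ĉ + (ĉ + ĉ) - (n̂ + n̂)
        ≡⟨ cong (λ x → x + x - (n̂ + n̂)) (sym n̂+d̂≡ĉ+ĉ) ⟩
      n̂ + d̂ + (n̂ + d̂) - (n̂ + n̂)
        ≡⟨ solve 2 (λ n̂ d̂ → n̂ :+ d̂ :+ (n̂ :+ d̂) :- (n̂ :+ n̂) := d̂ :+ d̂) refl n̂ d̂ ⟩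
      d̂ + d̂
        ≡⟨ sym (×-homo-+ 1ℚ d d) ⟩
      (d ℕ.+ d) × 1ℚ
        ∎)
    where
    open ≡-Reasoning
    d : ℕ
    d = 2 ℕ.* c ∸ n
    n̂ ĉ d̂ : ℚ
    n̂ = n × 1ℚ
    ĉ = c × 1ℚ
    d̂ = d × 1ℚ
    n̂+d̂≡ĉ+ĉ : n̂ + d̂ ≡ ĉ + ĉ
    n̂+d̂≡ĉ+ĉ = begin
      (n × 1ℚ) + (d × 1ℚ)  ≡⟨ sym (×-homo-+ 1ℚ n d) ⟩
      (n ℕ.+ d) × 1ℚ       ≡⟨ cong (_× 1ℚ) (trans (m+[n∸m]≡n n≤2c) (2*m≡m+m c)) ⟩
      (c ℕ.+ c) × 1ℚ       ≡⟨ ×-homo-+ 1ℚ c c ⟩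
      (c × 1ℚ) + (c × 1ℚ)  ∎
  ... | false | ofⁿ n≰2c = e ℕ.+ e , (begin
      slack n̂ ĉ 0ℚ
        ≡⟨ cong (λ x → slack x ĉ 0ℚ) n̂≡1+ĉ+ĉ+ê ⟩
      slack (1ℚ + (ĉ + ĉ) + ê) ĉ 0ℚ
        ≡⟨ solve 2 (λ ĉ ê → con (- 1ℚ)
                             :+ con (- 1ℚ) :* ((con 1ℚ :+ (ĉ :+ ĉ) :+ ê) :+ (con 1ℚ :+ (ĉ :+ ĉ) :+ ê)
                                                :- con 1ℚ :+ con (- (4 × 1ℚ)) :* ĉ)
                                          :* ((con 1ℚ :+ con 1ℚ) :* con 0ℚ :+ con (- 1ℚ))
                           := ê :+ ê)
                 refl ĉ ê ⟩
      ê + ê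
        ≡⟨ sym (×-homo-+ 1ℚ e e) ⟩
      (e ℕ.+ e) × 1ℚ
        ∎)
    where
    open ≡-Reasoning
    e : ℕ
    e = n ∸ suc (2 ℕ.* c)
    n̂ ĉ ê : ℚ
    n̂ = n × 1ℚ
    ĉ = c × 1ℚ
    ê = e × 1ℚ
    n̂≡1+ĉ+ĉ+ê : n̂ ≡ 1ℚ + (ĉ + ĉ) + ê
    n̂≡1+ĉ+ĉ+ê = begin
      n × 1ℚ                      ≡⟨ cong (_× 1ℚ) (sym (m+[n∸m]≡n (≰⇒> n≰2c))) ⟩
      (suc (2 ℕ.* c) ℕ.+ e) × 1ℚ  ≡⟨ ×-homo-+ 1ℚ (suc (2 ℕ.* c)) e ⟩
      1ℚ + (2 ℕ.* c) × 1ℚ + ê     ≡⟨ cong (λ k → 1ℚ + k × 1ℚ + ê) (2*m≡m+m c) ⟩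
      1ℚ + (c ℕ.+ c) × 1ℚ + ê     ≡⟨ cong (λ x → 1ℚ + x + ê) (×-homo-+ 1ℚ c c) ⟩
      1ℚ + (ĉ + ĉ) + ê            ∎

  inputSum : ∀ {k n} → (Fin k → Fin n) → Expr n
  inputSum {zero}  f = const 0ℚ
  inputSum {suc k} f = input (f zero) ⊕ inputSum (f ∘ suc)

  inputSum-count : ∀ {k n} (f : Fin k → Fin n) β → ⟦ inputSum f ⟧ (fromBool ∘ β) ≡ count (β ∘ f) × 1ℚ
  inputSum-count {zero}  f β = refl
  inputSum-count {suc k} f β =
    trans (cong₂ _+_ (fromBool≡ (β (f zero))) (inputSum-count (f ∘ suc) β))
          (sym (×-homo-+ 1ℚ (if β (f zero) then 1 else 0) (count (β ∘ f ∘ suc))))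
    where
    fromBool≡ : ∀ b → fromBool b ≡ (if b then 1 else 0) × 1ℚ
    fromBool≡ true  = refl
    fromBool≡ false = refl

  evalPoly-linear : ∀ {k n m} ρ c (f : Fin k → Fin n) →
                    evalPoly ρ (renamePoly (X {m = m}) (tabulate (λ j → c , var (f j) ∷ [])))
                    ≡ c * ⟦ inputSum f ⟧ (ρ ∘ var ∘ X)
  evalPoly-linear {zero}  ρ c f = sym (*-zeroʳ c)
  evalPoly-linear {suc k} ρ c f =
    trans (cong₂ _+_ (cong (c *_) (*-identityʳ (ρ (var (X (f zero)))))) (evalPoly-linear ρ c (f ∘ suc)))
          (sym (*-distribˡ-+ c (ρ (var (X (f zero)))) (⟦ inputSum (f ∘ suc) ⟧ (ρ ∘ var ∘ X))))

  qmajority-refutation : ∀ {n} (C : Circuit n) → Computes C majority → Σ[ r ∈ QSoSRefutation C ] Qsize r ≡ suc n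
  qmajority-refutation {n} C computes =
    map₂ (λ qu≡qᵤ → trans (cong length qu≡qᵤ) (cong suc (length-tabulate _))) (refutation-from-cone C qᵤ target-cone)
    where
    n̂ : ℚ
    n̂ = n × 1ℚ

    Q : Expr n
    Q = const (n̂ + n̂ - 1ℚ) ⊕ const (- (4 × 1ℚ)) ⊗ inputSum id

    qᵤ : Poly (Fin n)
    qᵤ = (n̂ + n̂ - 1ℚ , []) ∷ tabulate (λ j → - (4 × 1ℚ) , var j ∷ [])

    evalPoly-qᵤ : ∀ ρ → evalPoly ρ (renamePoly X qᵤ) ≡ ⟦ Q ⟧ (ρ ∘ var ∘ X)
    evalPoly-qᵤ ρ = cong₂ _+_ (*-identityʳ (n̂ + n̂ - 1ℚ)) (evalPoly-linear ρ (- (4 × 1ℚ)) id)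

    G : Expr n
    G = const (- 1ℚ) ⊕ const (- 1ℚ) ⊗ Q ⊗ (const (1ℚ + 1ℚ) ⊗ outputExpr C ⊕ const (- 1ℚ))

    G-natural : NaturalOnCube G
    G-natural β =
      map₂ (trans (cong₂ (slack n̂) (inputSum-count id β) (trans (outputExpr-sound β C) (cong fromBool (computes β)))))
           (slack-natural n (count β))

    target-cone : InCone (enc (QMajMatrix C)) (λ ρ → - (evalPoly ρ (renamePoly X qᵤ) * (1ℚ - (1ℚ + 1ℚ) * ρ (var U))) - 1ℚ)
    target-cone =
      cone-cong (λ ρ → trans (solve 3 (λ q o u →
                                           con (- 1ℚ) :+ con (- 1ℚ) :* q :* ((con 1ℚ :+ con 1ℚ) :* o :+ con (- 1ℚ))
                                           :+ (con 1ℚ :+ con 1ℚ) :* q :* (u :- (con 1ℚ :- o))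
                                        := :- (q :* (con 1ℚ :- (con 1ℚ :+ con 1ℚ) :* u)) :- con 1ℚ)
                                      refl (⟦ Q ⟧ (ρ ∘ var ∘ X)) (⟦ outputExpr C ⟧ (ρ ∘ var ∘ X)) (ρ (var U)))
                             (cong (λ q → - (q * (1ℚ - (1ℚ + 1ℚ) * ρ (var U))) - 1ℚ) (sym (evalPoly-qᵤ ρ))))
                (cone-+ (cone-cube X (λ i → input-boolean C computes (majority-sensitive i)) G G-natural)
                        (ideal⇒cone (poly-* (poly-const (1ℚ + 1ℚ)) (poly-⟦⟧ X Q) *ᴵ u-tracks C)))

open import Data.Nat using (ℕ; suc; _≤_; _*_)
open import Data.Nat.Properties using (≤-trans; ≤-reflexive; +-monoˡ-≤)
open import Data.Product using (Σ; ∃-syntax; _,_; map₂)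
open import Relation.Binary.PropositionalEquality using (subst; sym)

proposition3p10 : ∃[ c ] ∃[ n₀ ] (∀ (n : ℕ) → n₀ ≤ n →
                    (C : Circuit n) → Computes C majority →
                    Σ (QSoSRefutation C) (λ r → Qsize r ≤ c * n))
proposition3p10 = 2 , 1 , λ n 1≤n C computes →
  map₂ (λ size → ≤-trans (≤-reflexive size) (subst (suc n ≤_) (sym (2*m≡m+m n)) (+-monoˡ-≤ n 1≤n)))
       (qmajority-refutation C computes)
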